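{- Let $K$ be an integer and let $m>1$ be odd. Then: (1) if $m>3$, then $\omega_K(m)=4$ if and only if $\alpha_K(m)\equiv\pm1\pmod 4$; (2) $\omega_K(m)=2$ if and only if $4\mid\pi_K(m)$ and $2\mid\alpha_K(m)$; (3) $\omega_K(m)=1$ if and only if $4\nmid\pi_K(m)$.
   Context: For an integer $K$, the $K$-Fibonacci sequence is $F_{K,0}=0$, $F_{K,1}=1$, $F_{K,n}=KF_{K,n-1}+F_{K,n-2}$ for $n\ge2$. For an integer $m\ge 2$, $\pi_K(m)$ is the least positive period of $(F_{K,n}\bmod m)$, $\alpha_K(m)$ is the least positive index $n$ with $m\mid F_{K,n}$, and $\omega_K(m)$ is the number of indices $0\le n<\pi_K(m)$ with $m\mid F_{K,n}$. -}

module Defs where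

open import Data.Nat using (ℕ; zero; suc; _<_; _≤_)
open import Data.Integer using (ℤ; +_; _+_; _*_; _%ℕ_)
open import Data.Integer.Divisibility.Signed using (_∣_; _∣?_)
open import Relation.Binary.PropositionalEquality using (_≡_)
open import Relation.Nullary using (¬_; yes; no)
open import Data.Product using (_×_)

F : ℤ → ℕ → ℤ
F K zero = + 0
F K (suc zero) = + 1
F K (suc (suc n)) = K * F K (suc n) + F K n

IsPeriod : ℤ → ℕ → ℕ → Set
IsPeriod K m p = ∀ n → (+ m) ∣ (F K (n Data.Nat.+ p) Data.Integer.- F K n)
  where import Data.Nat

IsPi : ℤ → ℕ → ℕ → Set
IsPi K m p = (0 < p × IsPeriod K m p) × (∀ q → 0 < q → IsPeriod K m q → p ≤ q)

IsAlpha : ℤ → ℕ → ℕ → Set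
IsAlpha K m a = (0 < a × (+ m) ∣ F K a) × (∀ b → 0 < b → (+ m) ∣ F K b → a ≤ b)

countZeros : ℤ → ℕ → ℕ → ℕ
countZeros K m zero = 0
countZeros K m (suc N) with (+ m) ∣? F K N
... | yes _ = suc (countZeros K m N)
... | no  _ = countZeros K m N

-- ω_K(m) = number of indices 0 ≤ n < π_K(m) with m ∣ F K n (given p = π_K(m))
ω : ℤ → ℕ → ℕ → ℕ
ω K m p = countZeros K m p

{-# OPTIONS --safe #-}

-- Let α = α_K(m) and c = F(α - 1). Since m ∣ F(α), the addition formula gives
-- F(n + jα) ≡ cʲ F(n) (mod m), and d'Ocagne's identity gives c² ≡ (-1)^α, so c is a unit.
-- Hence the zeros of F modulo m are exactly the multiples of α, π = tα where t is the
-- multiplicative order of c modulo m, and ω = t. If α is odd then c² ≡ -1 ≢ 1 (m is odd),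
-- so t = 4. If α is even then c² ≡ 1, so t ∈ {1, 2}, and t = 1 forces α ≡ 2 (mod 4):
-- d'Ocagne also gives F(α - n) ≡ (-1)^(n+1) c F(n), so 4 ∣ α and c ≡ 1 would give
-- 2 F(α/2) ≡ 0, hence m ∣ F(α/2), contradicting the minimality of α.

module Submission where

open import Defs
open import Data.Nat using (ℕ; _<_; _%_)
open import Data.Nat.Divisibility using (_∣_)
open import Data.Sum using (_⊎_)
open import Data.Product using (_×_)
open import Function.Bundles using (_⇔_)
open import Relation.Nullary using (¬_)
open import Relation.Binary.PropositionalEquality using (_≡_)
open import Data.Integer using (ℤ)

open import Data.Nat as ℕ using (zero; suc; _≤_; _/_; s≤s)
import Data.Nat.Properties as ℕ
import Data.Nat.DivMod as ℕ
import Data.Nat.Divisibility as ℕ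
open import Data.Integer using (+_; -_; _+_; _-_; _*_; _^_; 0ℤ; 1ℤ; -1ℤ)
import Data.Integer.Properties as ℤ
import Data.Integer.Divisibility.Signed as ℤ
open import Data.Integer.Tactic.RingSolver using (solve-∀)
open import Data.Product using (_,_; ∃-syntax)
open import Data.Sum using (inj₁; inj₂)
open import Function.Bundles using (mk⇔; Equivalence)
open import Relation.Binary.Bundles using (Setoid)
open import Relation.Binary.Structures using (IsEquivalence)
import Relation.Binary.Reasoning.Setoid as SetoidReasoning
open import Relation.Binary.PropositionalEquality
  using (refl; sym; trans; cong; cong₂; subst; module ≡-Reasoning)
open import Relation.Nullary using (Dec; yes; no; contradiction)
open import Relation.Nullary.Decidable using (map′)

-1^n*-1^n≡1 : ∀ n → (-1ℤ) ^ n * (-1ℤ) ^ n ≡ 1ℤ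
-1^n*-1^n≡1 zero    = refl
-1^n*-1^n≡1 (suc n) = trans (sign-squares ((-1ℤ) ^ n)) (-1^n*-1^n≡1 n)
  where
  sign-squares : ∀ s → (-1ℤ * s) * (-1ℤ * s) ≡ s * s
  sign-squares = solve-∀

-1^[k*2]≡1 : ∀ k → (-1ℤ) ^ (k ℕ.* 2) ≡ 1ℤ
-1^[k*2]≡1 k = begin
  (-1ℤ) ^ (k ℕ.* 2)                   ≡⟨ ℤ.^-*-assoc -1ℤ k 2 ⟨
  (-1ℤ) ^ k * ((-1ℤ) ^ k * 1ℤ)        ≡⟨ cong ((-1ℤ) ^ k *_) (ℤ.*-identityʳ _) ⟩
  (-1ℤ) ^ k * (-1ℤ) ^ k               ≡⟨ -1^n*-1^n≡1 k ⟩
  1ℤ                                  ∎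
  where open ≡-Reasoning

-1^n≡-1^[n%2] : ∀ n → (-1ℤ) ^ n ≡ (-1ℤ) ^ (n % 2)
-1^n≡-1^[n%2] n = begin
  (-1ℤ) ^ n                                   ≡⟨ cong ((-1ℤ) ^_) (ℕ.m≡m%n+[m/n]*n n 2) ⟩
  (-1ℤ) ^ (n % 2 ℕ.+ (n / 2) ℕ.* 2)           ≡⟨ ℤ.^-distribˡ-+-* -1ℤ (n % 2) _ ⟩
  (-1ℤ) ^ (n % 2) * (-1ℤ) ^ ((n / 2) ℕ.* 2)   ≡⟨ cong ((-1ℤ) ^ (n % 2) *_) (-1^[k*2]≡1 (n / 2)) ⟩
  (-1ℤ) ^ (n % 2) * 1ℤ                        ≡⟨ ℤ.*-identityʳ _ ⟩
  (-1ℤ) ^ (n % 2)                             ∎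
  where open ≡-Reasoning

n%4%2≡n%2 : ∀ n → n % 4 % 2 ≡ n % 2
n%4%2≡n%2 n = ℕ.m∣n⇒o%n%m≡o%m 2 4 n (ℕ.divides 2 refl)

n%4≡1⊎3⇒¬2∣n : ∀ {n} → n % 4 ≡ 1 ⊎ n % 4 ≡ 3 → ¬ 2 ∣ n
n%4≡1⊎3⇒¬2∣n {n} n%4≡1⊎3 2∣n =
  odd-remainder n%4≡1⊎3 (trans (n%4%2≡n%2 n) (ℕ.n∣m⇒m%n≡0 n 2 2∣n))
  where
  odd-remainder : ∀ {r} → r ≡ 1 ⊎ r ≡ 3 → ¬ r % 2 ≡ 0
  odd-remainder (inj₁ refl) ()
  odd-remainder (inj₂ refl) ()

module Fibonacci (K : ℤ) where

  F-+ : ∀ k n → F K (n ℕ.+ suc k) ≡ F K (suc k) * F K (suc n) + F K k * F K n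
  F-+ k zero          = base (F K (suc k)) (F K k)
    where
    base : ∀ x y → x ≡ x * 1ℤ + y * 0ℤ
    base = solve-∀
  F-+ k (suc zero)    = base K (F K (suc k)) (F K k)
    where
    base : ∀ K x y → K * x + y ≡ x * (K * 1ℤ + 0ℤ) + y * 1ℤ
    base = solve-∀
  F-+ k (suc (suc n)) = begin
    K * F K (suc n ℕ.+ suc k) + F K (n ℕ.+ suc k)
      ≡⟨ cong₂ (λ x y → K * x + y) (F-+ k (suc n)) (F-+ k n) ⟩
    K * (A * F K (suc (suc n)) + B * F K (suc n)) + (A * F K (suc n) + B * F K n)
      ≡⟨ step K A B (F K (suc n)) (F K n) ⟩
    A * F K (suc (suc (suc n))) + B * F K (suc (suc n))
      ∎
    where
    open ≡-Reasoning
    A B : ℤ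
    A = F K (suc k)
    B = F K k
    step : ∀ K A B x y → K * (A * (K * x + y) + B * x) + (A * x + B * y)
                         ≡ A * (K * (K * x + y) + x) + B * (K * x + y)
    step = solve-∀

  -- d'Ocagne's identity: the Casoratian of the solutions n ↦ F (n + j) and F changes sign at each step.
  F-dOcagne : ∀ j n → F K (n ℕ.+ j) * F K (suc n) - F K (suc n ℕ.+ j) * F K n ≡ (-1ℤ) ^ n * F K j
  F-dOcagne j zero    = base (F K j) (F K (suc j))
    where
    base : ∀ x y → x * 1ℤ - y * 0ℤ ≡ 1ℤ * x
    base = solve-∀
  F-dOcagne j (suc n) = begin
    F K (suc n ℕ.+ j) * F K (suc (suc n)) - F K (suc (suc n) ℕ.+ j) * F K (suc n)
      ≡⟨ step K (F K (n ℕ.+ j)) (F K (suc n ℕ.+ j)) (F K n) (F K (suc n)) ⟩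
    -1ℤ * (F K (n ℕ.+ j) * F K (suc n) - F K (suc n ℕ.+ j) * F K n)
      ≡⟨ cong (-1ℤ *_) (F-dOcagne j n) ⟩
    -1ℤ * ((-1ℤ) ^ n * F K j)
      ≡⟨ ℤ.*-assoc -1ℤ ((-1ℤ) ^ n) (F K j) ⟨
    (-1ℤ) ^ suc n * F K j
      ∎
    where
    open ≡-Reasoning
    step : ∀ K x₀ x₁ y₀ y₁ →
           x₁ * (K * y₁ + y₀) - (K * x₁ + x₀) * y₁ ≡ -1ℤ * (x₀ * y₁ - x₁ * y₀)
    step = solve-∀

module Congruence (m : ℕ) where

  infix 4 _≈_
  record _≈_ (x y : ℤ) : Set where
    constructor mod
    field m∣x-y : + m ℤ.∣ x - y
  open _≈_ public

  ≈-refl : ∀ {x} → x ≈ x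
  ≈-refl {x} = mod (subst (+ m ℤ.∣_) (sym (ℤ.+-inverseʳ x)) (ℤ.divides 0ℤ refl))

  ≈-sym : ∀ {x y} → x ≈ y → y ≈ x
  ≈-sym {x} {y} (mod m∣x-y) = mod (subst (+ m ℤ.∣_) (swap x y) (ℤ.∣m⇒∣-m m∣x-y))
    where
    swap : ∀ x y → - (x - y) ≡ y - x
    swap = solve-∀

  ≈-trans : ∀ {x y z} → x ≈ y → y ≈ z → x ≈ z
  ≈-trans {x} {y} {z} (mod m∣x-y) (mod m∣y-z) =
    mod (subst (+ m ℤ.∣_) (difference-chain x y z) (ℤ.∣m∣n⇒∣m+n m∣x-y m∣y-z))
    where
    difference-chain : ∀ x y z → (x - y) + (y - z) ≡ x - z
    difference-chain = solve-∀

  ≈-isEquivalence : IsEquivalence _≈_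
  ≈-isEquivalence = record { refl = ≈-refl ; sym = ≈-sym ; trans = ≈-trans }

  ≈-setoid : Setoid _ _
  ≈-setoid = record { isEquivalence = ≈-isEquivalence }

  module ≈-Reasoning = SetoidReasoning ≈-setoid

  _≈?_ : ∀ x y → Dec (x ≈ y)
  x ≈? y = map′ mod m∣x-y (+ m ℤ.∣? x - y)

  ∣⇒≈0 : ∀ {x} → + m ℤ.∣ x → x ≈ 0ℤ
  ∣⇒≈0 {x} m∣x = mod (subst (+ m ℤ.∣_) (sym (ℤ.+-identityʳ x)) m∣x)

  ≈0⇒∣ : ∀ {x} → x ≈ 0ℤ → + m ℤ.∣ x
  ≈0⇒∣ {x} (mod m∣x-0) = subst (+ m ℤ.∣_) (ℤ.+-identityʳ x) m∣x-0

  +-cong : ∀ {x y u v} → x ≈ y → u ≈ v → x + u ≈ y + v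
  +-cong {x} {y} {u} {v} (mod m∣x-y) (mod m∣u-v) =
    mod (subst (+ m ℤ.∣_) (interchange x y u v) (ℤ.∣m∣n⇒∣m+n m∣x-y m∣u-v))
    where
    interchange : ∀ x y u v → (x - y) + (u - v) ≡ (x + u) - (y + v)
    interchange = solve-∀

  -‿cong : ∀ {x y} → x ≈ y → - x ≈ - y
  -‿cong {x} {y} (mod m∣x-y) = mod (subst (+ m ℤ.∣_) (negate x y) (ℤ.∣m⇒∣-m m∣x-y))
    where
    negate : ∀ x y → - (x - y) ≡ - x - - y
    negate = solve-∀

  *-congˡ : ∀ k {x y} → x ≈ y → k * x ≈ k * y
  *-congˡ k {x} {y} (mod m∣x-y) = mod (subst (+ m ℤ.∣_) (distribute k x y) (ℤ.∣n⇒∣m*n k m∣x-y))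
    where
    distribute : ∀ k x y → k * (x - y) ≡ k * x - k * y
    distribute = solve-∀

  *-cong : ∀ {x y u v} → x ≈ y → u ≈ v → x * u ≈ y * v
  *-cong {x} {y} {u} {v} x≈y u≈v = begin
    x * u ≡⟨ ℤ.*-comm x u ⟩
    u * x ≈⟨ *-congˡ u x≈y ⟩
    u * y ≡⟨ ℤ.*-comm u y ⟩
    y * u ≈⟨ *-congˡ y u≈v ⟩
    y * v ∎
    where open ≈-Reasoning

  ^-cong : ∀ {x y} n → x ≈ y → x ^ n ≈ y ^ n
  ^-cong zero    x≈y = ≈-refl
  ^-cong (suc n) x≈y = *-cong x≈y (^-cong n x≈y)

  module _ (m%2≡1 : m % 2 ≡ 1) where

    -- With m = 2h + 1, the inverse of 2 modulo m is h + 1.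
    x+x≈0⇒x≈0 : ∀ {x} → x + x ≈ 0ℤ → x ≈ 0ℤ
    x+x≈0⇒x≈0 {x} x+x≈0 = begin
      x                                                ≡⟨ halve (+ h) x ⟩
      (1ℤ + + h) * (x + x) - (1ℤ + + h * + 2) * x      ≡⟨ cong (λ M → (1ℤ + + h) * (x + x) - M * x) +m≡1+2h ⟨
      (1ℤ + + h) * (x + x) - + m * x                   ≈⟨ +-cong (*-congˡ (1ℤ + + h) x+x≈0) (-‿cong m*x≈0) ⟩
      (1ℤ + + h) * 0ℤ - 0ℤ                             ≡⟨ cong (_- 0ℤ) (ℤ.*-zeroʳ (1ℤ + + h)) ⟩
      0ℤ                                               ∎
      where
      open ≈-Reasoning
      h : ℕ
      h = m / 2
      +m≡1+2h : + m ≡ 1ℤ + + h * + 2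
      +m≡1+2h = trans (cong +_ m≡1+h*2) (trans (ℤ.pos-+ 1 (h ℕ.* 2)) (cong (λ k → 1ℤ + k) (ℤ.pos-* h 2)))
        where
        m≡1+h*2 : m ≡ 1 ℕ.+ h ℕ.* 2
        m≡1+h*2 = trans (ℕ.m≡m%n+[m/n]*n m 2) (cong (ℕ._+ h ℕ.* 2) m%2≡1)
      m*x≈0 : + m * x ≈ 0ℤ
      m*x≈0 = ∣⇒≈0 (ℤ.∣m⇒∣m*n x ℤ.∣-refl)
      halve : ∀ h x → x ≡ (1ℤ + h) * (x + x) - (1ℤ + h * + 2) * x
      halve = solve-∀

    1≉-1 : 1 < m → ¬ 1ℤ ≈ -1ℤ
    1≉-1 1<m 1≈-1 = ℕ.<⇒≱ 1<m (ℕ.∣⇒≤ (ℤ.∣⇒∣ᵤ (≈0⇒∣ 1≈0)))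
      where
      1≈0 : 1ℤ ≈ 0ℤ
      1≈0 = x+x≈0⇒x≈0 (+-cong 1≈-1 (≈-refl {1ℤ}))

  IsOrder : ℤ → ℕ → Set
  IsOrder c t = (0 < t × c ^ t ≈ 1ℤ) × (∀ j → 0 < j → c ^ j ≈ 1ℤ → t ≤ j)

  order≡1 : ∀ {c t} → c ≈ 1ℤ → IsOrder c t → t ≡ 1
  order≡1 {c} c≈1 ((0<t , _) , least) =
    ℕ.≤-antisym (least 1 ℕ.z<s (subst (_≈ 1ℤ) (sym (ℤ.^-identityʳ c)) c≈1)) 0<t

  order≡2 : ∀ {c t} → ¬ c ≈ 1ℤ → c ^ 2 ≈ 1ℤ → IsOrder c t → t ≡ 2
  order≡2 {c} c≉1 c²≈1 ((0<t , c^t≈1) , least) = go 0<t (least 2 ℕ.z<s c²≈1) c^t≈1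
    where
    go : ∀ {t} → 0 < t → t ≤ 2 → c ^ t ≈ 1ℤ → t ≡ 2
    go {1} _ _ c¹≈1 = contradiction (subst (_≈ 1ℤ) (ℤ.^-identityʳ c) c¹≈1) c≉1
    go {2} _ _ _    = refl
    go {suc (suc (suc _))} _ (s≤s (s≤s ())) _

  order≡4 : ∀ {c t} → ¬ 1ℤ ≈ -1ℤ → c ^ 2 ≈ -1ℤ → IsOrder c t → t ≡ 4
  order≡4 {c} 1≉-1 c²≈-1 ((0<t , c^t≈1) , least) = go 0<t (least 4 ℕ.z<s c⁴≈1) c^t≈1
    where
    open ≈-Reasoning
    c²≉1 : ¬ c ^ 2 ≈ 1ℤ
    c²≉1 c²≈1 = 1≉-1 (≈-trans (≈-sym c²≈1) c²≈-1)
    c≉1 : ¬ c ≈ 1ℤ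
    c≉1 c≈1 = c²≉1 (^-cong 2 c≈1)
    c⁴≈1 : c ^ 4 ≈ 1ℤ
    c⁴≈1 = begin
      c ^ 4         ≡⟨ ℤ.^-distribˡ-+-* c 2 2 ⟩
      c ^ 2 * c ^ 2 ≈⟨ *-cong c²≈-1 c²≈-1 ⟩
      -1ℤ * -1ℤ     ≡⟨⟩
      1ℤ            ∎
    go : ∀ {t} → 0 < t → t ≤ 4 → c ^ t ≈ 1ℤ → t ≡ 4
    go {1} _ _ c¹≈1 = contradiction (subst (_≈ 1ℤ) (ℤ.^-identityʳ c) c¹≈1) c≉1
    go {2} _ _ c²≈1 = contradiction c²≈1 c²≉1
    go {3} _ _ c³≈1 = contradiction c≈1 c≉1
      where
      c≈1 : c ≈ 1ℤ
      c≈1 = begin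
        c         ≡⟨ ℤ.*-identityʳ c ⟨
        c * 1ℤ    ≈⟨ *-congˡ c c³≈1 ⟨
        c * c ^ 3 ≈⟨ c⁴≈1 ⟩
        1ℤ        ∎
    go {4} _ _ _    = refl
    go {suc (suc (suc (suc (suc _))))} _ (s≤s (s≤s (s≤s (s≤s ())))) _

countZeros-suc-∣ : ∀ {K m n} → + m ℤ.∣ F K n → countZeros K m (suc n) ≡ suc (countZeros K m n)
countZeros-suc-∣ {K} {m} {n} m∣F[n] with + m ℤ.∣? F K n
... | yes _      = refl
... | no m∤F[n]  = contradiction m∣F[n] m∤F[n]

countZeros-suc-∤ : ∀ {K m n} → ¬ + m ℤ.∣ F K n → countZeros K m (suc n) ≡ countZeros K m n
countZeros-suc-∤ {K} {m} {n} m∤F[n] with + m ℤ.∣? F K n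
... | yes m∣F[n] = contradiction m∣F[n] m∤F[n]
... | no _       = refl

countZeros-multiples : ∀ {K m} α-1 → (∀ n → + m ℤ.∣ F K n ⇔ suc α-1 ∣ n) →
                       ∀ t → countZeros K m (t ℕ.* suc α-1) ≡ t
countZeros-multiples {K} {m} α-1 zeros = count
  where
  α : ℕ
  α = suc α-1
  count : ∀ t → countZeros K m (t ℕ.* α) ≡ t
  block : ∀ t i → i < α → countZeros K m (suc i ℕ.+ t ℕ.* α) ≡ suc t
  count zero    = refl
  count (suc t) = block t α-1 (ℕ.n<1+n α-1)
  block t zero    _   =
    trans (countZeros-suc-∣ (Equivalence.from (zeros _) (ℕ.n∣m*n t))) (cong suc (count t))
  block t (suc i) i<α = trans (countZeros-suc-∤ m∤F) (block t i (ℕ.<-trans (ℕ.n<1+n i) i<α))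
    where
    m∤F : ¬ + m ℤ.∣ F K (suc i ℕ.+ t ℕ.* α)
    m∤F m∣F = ℕ.<⇒≱ i<α (ℕ.∣⇒≤ (ℕ.∣m+n∣m⇒∣n α∣ (ℕ.n∣m*n t)))
      where
      α∣ : α ∣ t ℕ.* α ℕ.+ suc i
      α∣ = subst (α ∣_) (ℕ.+-comm (suc i) _) (Equivalence.to (zeros _) m∣F)

data ωClass (α t : ℕ) : Set where
  ω≡4 : α % 4 ≡ 1 ⊎ α % 4 ≡ 3 → t ≡ 4 → ωClass α t
  ω≡2 : 2 ∣ α → t ≡ 2 → ωClass α t
  ω≡1 : 2 ∣ α → ¬ 4 ∣ α → t ≡ 1 → ωClass α t

ωClass⇒criteria : ∀ {m w p α t} → w ≡ t → p ≡ t ℕ.* α → ωClass α t →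
    (3 < m → (w ≡ 4 ⇔ (α % 4 ≡ 1 ⊎ α % 4 ≡ 3)))
    × (w ≡ 2 ⇔ (4 ∣ p × 2 ∣ α))
    × (w ≡ 1 ⇔ (¬ (4 ∣ p)))
ωClass⇒criteria {α = α} refl refl (ω≡4 α-odd refl) =
    (λ _ → mk⇔ (λ _ → α-odd) (λ _ → refl))
  , mk⇔ (λ ()) (λ (_ , 2∣α) → contradiction 2∣α (n%4≡1⊎3⇒¬2∣n α-odd))
  , mk⇔ (λ ()) (λ 4∤p → contradiction (ℕ.m∣m*n α) 4∤p)
ωClass⇒criteria refl refl (ω≡2 2∣α refl) =
    (λ _ → mk⇔ (λ ()) (λ α-odd → contradiction 2∣α (n%4≡1⊎3⇒¬2∣n α-odd)))
  , mk⇔ (λ _ → ℕ.*-monoʳ-∣ 2 2∣α , 2∣α) (λ _ → refl)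
  , mk⇔ (λ ()) (λ 4∤p → contradiction (ℕ.*-monoʳ-∣ 2 2∣α) 4∤p)
ωClass⇒criteria {α = α} refl refl (ω≡1 2∣α 4∤α refl) =
    (λ _ → mk⇔ (λ ()) (λ α-odd → contradiction 2∣α (n%4≡1⊎3⇒¬2∣n α-odd)))
  , mk⇔ (λ ()) (λ (4∣p , _) → contradiction (subst (4 ∣_) (ℕ.*-identityˡ α) 4∣p) 4∤α)
  , mk⇔ (λ _ 4∣p → 4∤α (subst (4 ∣_) (ℕ.*-identityˡ α) 4∣p)) (λ _ → refl)

module Vanishing (K : ℤ) (m : ℕ) (α-1 : ℕ) (m∣F[α] : + m ℤ.∣ F K (suc α-1)) where
  open Fibonacci K
  open Congruence m

  α : ℕ
  α = suc α-1

  c : ℤ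
  c = F K α-1

  F[α]≈0 : F K α ≈ 0ℤ
  F[α]≈0 = ∣⇒≈0 m∣F[α]

  F[1+α]≈c : F K (suc α) ≈ c
  F[1+α]≈c = begin
    K * F K α + c  ≈⟨ +-cong (*-congˡ K F[α]≈0) ≈-refl ⟩
    K * 0ℤ + c     ≡⟨ cong (_+ c) (ℤ.*-zeroʳ K) ⟩
    0ℤ + c         ≡⟨ ℤ.+-identityˡ c ⟩
    c              ∎
    where open ≈-Reasoning

  F[n+α]≈c*F[n] : ∀ n → F K (n ℕ.+ α) ≈ c * F K n
  F[n+α]≈c*F[n] n = begin
    F K (n ℕ.+ α)                     ≡⟨ F-+ α-1 n ⟩
    F K α * F K (suc n) + c * F K n   ≈⟨ +-cong (*-cong F[α]≈0 ≈-refl) ≈-refl ⟩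
    0ℤ * F K (suc n) + c * F K n      ≡⟨ cong (_+ c * F K n) (ℤ.*-zeroˡ (F K (suc n))) ⟩
    0ℤ + c * F K n                    ≡⟨ ℤ.+-identityˡ (c * F K n) ⟩
    c * F K n                         ∎
    where open ≈-Reasoning

  F[n+j*α]≈c^j*F[n] : ∀ j n → F K (n ℕ.+ j ℕ.* α) ≈ c ^ j * F K n
  F[n+j*α]≈c^j*F[n] zero    n = begin
    F K (n ℕ.+ 0)  ≡⟨ cong (F K) (ℕ.+-identityʳ n) ⟩
    F K n          ≡⟨ ℤ.*-identityˡ (F K n) ⟨
    1ℤ * F K n     ∎
    where open ≈-Reasoning
  F[n+j*α]≈c^j*F[n] (suc j) n = begin
    F K (n ℕ.+ (α ℕ.+ j ℕ.* α))   ≡⟨ cong (λ k → F K (n ℕ.+ k)) (ℕ.+-comm α _) ⟩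
    F K (n ℕ.+ (j ℕ.* α ℕ.+ α))   ≡⟨ cong (F K) (ℕ.+-assoc n _ α) ⟨
    F K (n ℕ.+ j ℕ.* α ℕ.+ α)     ≈⟨ F[n+α]≈c*F[n] (n ℕ.+ j ℕ.* α) ⟩
    c * F K (n ℕ.+ j ℕ.* α)       ≈⟨ *-congˡ c (F[n+j*α]≈c^j*F[n] j n) ⟩
    c * (c ^ j * F K n)           ≡⟨ ℤ.*-assoc c (c ^ j) (F K n) ⟨
    c ^ suc j * F K n             ∎
    where open ≈-Reasoning

  F-reflect : ∀ n j → n ℕ.+ j ≡ α → (-1ℤ) ^ n * F K j ≈ - (c * F K n)
  F-reflect n j n+j≡α = begin
    (-1ℤ) ^ n * F K j
      ≡⟨ F-dOcagne j n ⟨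
    F K (n ℕ.+ j) * F K (suc n) - F K (suc (n ℕ.+ j)) * F K n
      ≈⟨ +-cong (*-cong F[n+j]≈0 ≈-refl) (-‿cong (*-cong F[1+n+j]≈c ≈-refl)) ⟩
    0ℤ * F K (suc n) - c * F K n
      ≡⟨ cong (_- c * F K n) (ℤ.*-zeroˡ (F K (suc n))) ⟩
    0ℤ - c * F K n
      ≡⟨ ℤ.+-identityˡ (- (c * F K n)) ⟩
    - (c * F K n)
      ∎
    where
    open ≈-Reasoning
    F[n+j]≈0 : F K (n ℕ.+ j) ≈ 0ℤ
    F[n+j]≈0 = subst (λ k → F K k ≈ 0ℤ) (sym n+j≡α) F[α]≈0
    F[1+n+j]≈c : F K (suc (n ℕ.+ j)) ≈ c
    F[1+n+j]≈c = subst (λ k → F K (suc k) ≈ c) (sym n+j≡α) F[1+α]≈c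

  c²≈-1^α : c ^ 2 ≈ (-1ℤ) ^ α
  c²≈-1^α = begin
    c ^ 2                    ≡⟨ cong (c *_) (ℤ.*-identityʳ c) ⟩
    c * c                    ≡⟨ ℤ.neg-involutive (c * c) ⟨
    - - (c * c)              ≈⟨ -‿cong (F-reflect α-1 1 (ℕ.+-comm α-1 1)) ⟨
    - ((-1ℤ) ^ α-1 * 1ℤ)     ≡⟨ cong -_ (ℤ.*-identityʳ ((-1ℤ) ^ α-1)) ⟩
    - (-1ℤ) ^ α-1            ≡⟨ ℤ.-1*i≡-i ((-1ℤ) ^ α-1) ⟨
    (-1ℤ) ^ α                ∎
    where open ≈-Reasoning

  c*y≈0⇒y≈0 : ∀ {y} → c * y ≈ 0ℤ → y ≈ 0ℤ
  c*y≈0⇒y≈0 {y} c*y≈0 = begin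
    y                 ≡⟨ ℤ.*-identityˡ y ⟨
    1ℤ * y            ≡⟨ cong (_* y) (-1^n*-1^n≡1 α) ⟨
    (s * s) * y       ≈⟨ *-cong (*-congˡ s c²≈-1^α) ≈-refl ⟨
    (s * c ^ 2) * y   ≡⟨ regroup s c y ⟩
    (s * c) * (c * y) ≈⟨ *-congˡ (s * c) c*y≈0 ⟩
    (s * c) * 0ℤ      ≡⟨ ℤ.*-zeroʳ (s * c) ⟩
    0ℤ                ∎
    where
    open ≈-Reasoning
    s : ℤ
    s = (-1ℤ) ^ α
    regroup : ∀ s c y → (s * (c * (c * 1ℤ))) * y ≡ (s * c) * (c * y)
    regroup = solve-∀

  c^j*y≈0⇒y≈0 : ∀ j {y} → c ^ j * y ≈ 0ℤ → y ≈ 0ℤ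
  c^j*y≈0⇒y≈0 zero    {y} 1*y≈0 = subst (_≈ 0ℤ) (ℤ.*-identityˡ y) 1*y≈0
  c^j*y≈0⇒y≈0 (suc j) {y} c^[1+j]*y≈0 =
    c^j*y≈0⇒y≈0 j (c*y≈0⇒y≈0 (subst (_≈ 0ℤ) (ℤ.*-assoc c (c ^ j) y) c^[1+j]*y≈0))

  IsPeriod-*α⇔c^j≈1 : ∀ j → IsPeriod K m (j ℕ.* α) ⇔ c ^ j ≈ 1ℤ
  IsPeriod-*α⇔c^j≈1 j = mk⇔ to from
    where
    open ≈-Reasoning
    to : IsPeriod K m (j ℕ.* α) → c ^ j ≈ 1ℤ
    to period = begin
      c ^ j                 ≡⟨ ℤ.*-identityʳ (c ^ j) ⟨
      c ^ j * F K 1         ≈⟨ F[n+j*α]≈c^j*F[n] j 1 ⟨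
      F K (1 ℕ.+ j ℕ.* α)   ≈⟨ mod (period 1) ⟩
      1ℤ                    ∎
    from : c ^ j ≈ 1ℤ → IsPeriod K m (j ℕ.* α)
    from c^j≈1 n = m∣x-y (begin
      F K (n ℕ.+ j ℕ.* α)   ≈⟨ F[n+j*α]≈c^j*F[n] j n ⟩
      c ^ j * F K n         ≈⟨ *-cong c^j≈1 ≈-refl ⟩
      1ℤ * F K n            ≡⟨ ℤ.*-identityˡ (F K n) ⟩
      F K n                 ∎)

  module EntryPoint (α-least : ∀ b → 0 < b → + m ℤ.∣ F K b → α ≤ b) where

    m∣F[n]⇔α∣n : ∀ n → + m ℤ.∣ F K n ⇔ α ∣ n
    m∣F[n]⇔α∣n n = mk⇔ m∣F[n]⇒α∣n α∣n⇒m∣F[n]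
      where
      open ≈-Reasoning
      m∣F[r]⇒r≡0 : ∀ r → r < α → + m ℤ.∣ F K r → r ≡ 0
      m∣F[r]⇒r≡0 zero    _   _      = refl
      m∣F[r]⇒r≡0 (suc r) r<α m∣F[r] = contradiction (α-least (suc r) ℕ.z<s m∣F[r]) (ℕ.<⇒≱ r<α)
      m∣F[n]⇒α∣n : + m ℤ.∣ F K n → α ∣ n
      m∣F[n]⇒α∣n m∣F[n] =
        ℕ.m%n≡0⇒n∣m n α (m∣F[r]⇒r≡0 (n % α) (ℕ.m%n<n n α) (≈0⇒∣ F[n%α]≈0))
        where
        F[n%α]≈0 : F K (n % α) ≈ 0ℤ
        F[n%α]≈0 = c^j*y≈0⇒y≈0 (n / α) (begin
          c ^ (n / α) * F K (n % α)         ≈⟨ F[n+j*α]≈c^j*F[n] (n / α) (n % α) ⟨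
          F K (n % α ℕ.+ (n / α) ℕ.* α)     ≡⟨ cong (F K) (ℕ.m≡m%n+[m/n]*n n α) ⟨
          F K n                             ≈⟨ ∣⇒≈0 m∣F[n] ⟩
          0ℤ                                ∎)
      α∣n⇒m∣F[n] : α ∣ n → + m ℤ.∣ F K n
      α∣n⇒m∣F[n] (ℕ.divides j refl) = ≈0⇒∣ (begin
        F K (j ℕ.* α)   ≈⟨ F[n+j*α]≈c^j*F[n] j 0 ⟩
        c ^ j * 0ℤ      ≡⟨ ℤ.*-zeroʳ (c ^ j) ⟩
        0ℤ              ∎)

    π≡ord*α : ∀ {p} → IsPi K m p → ∃[ t ] p ≡ t ℕ.* α × IsOrder c t
    π≡ord*α {p} ((_ , p-period) , _)
      with Equivalence.to (m∣F[n]⇔α∣n p) (≈0⇒∣ (mod (p-period 0)))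
    π≡ord*α ((() , _) , _) | ℕ.divides zero refl
    π≡ord*α ((_ , p-period) , p-least) | ℕ.divides t@(suc _) refl =
      t , refl , ((ℕ.z<s , Equivalence.to (IsPeriod-*α⇔c^j≈1 t) p-period) , t-least)
      where
      t-least : ∀ j → 0 < j → c ^ j ≈ 1ℤ → t ≤ j
      t-least j@(suc _) _ c^j≈1 =
        ℕ.*-cancelʳ-≤ t j α (p-least (j ℕ.* α) ℕ.z<s (Equivalence.from (IsPeriod-*α⇔c^j≈1 j) c^j≈1))

    module _ (m%2≡1 : m % 2 ≡ 1) where

      4∣α⇒c≉1 : 4 ∣ α → ¬ c ≈ 1ℤ
      4∣α⇒c≉1 (ℕ.divides (suc q) α≡[1+q]*4) c≈1 = ℕ.<⇒≱ b<α (α-least b ℕ.z<s (≈0⇒∣ F[b]≈0))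
        where
        open ≈-Reasoning
        b : ℕ
        b = suc q ℕ.* 2
        b+b≡α : b ℕ.+ b ≡ α
        b+b≡α = trans (sym (ℕ.*-distribˡ-+ (suc q) 2 2)) (sym α≡[1+q]*4)
        b<α : b < α
        b<α = subst (b <_) b+b≡α (ℕ.m<m+n b ℕ.z<s)
        F[b]≈-F[b] : F K b ≈ - F K b
        F[b]≈-F[b] = begin
          F K b                 ≡⟨ ℤ.*-identityˡ (F K b) ⟨
          1ℤ * F K b            ≡⟨ cong (_* F K b) (-1^[k*2]≡1 (suc q)) ⟨
          (-1ℤ) ^ b * F K b     ≈⟨ F-reflect b b b+b≡α ⟩
          - (c * F K b)         ≈⟨ -‿cong (*-cong c≈1 ≈-refl) ⟩
          - (1ℤ * F K b)        ≡⟨ cong -_ (ℤ.*-identityˡ (F K b)) ⟩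
          - F K b               ∎
        F[b]≈0 : F K b ≈ 0ℤ
        F[b]≈0 = x+x≈0⇒x≈0 m%2≡1 (begin
          F K b + F K b         ≈⟨ +-cong F[b]≈-F[b] ≈-refl ⟩
          - F K b + F K b       ≡⟨ ℤ.+-inverseˡ (F K b) ⟩
          0ℤ                    ∎)

      c²≈-1^[r%2] : ∀ {r} → α % 4 ≡ r → c ^ 2 ≈ (-1ℤ) ^ (r % 2)
      c²≈-1^[r%2] {r} α%4≡r = begin
        c ^ 2                   ≈⟨ c²≈-1^α ⟩
        (-1ℤ) ^ α               ≡⟨ -1^n≡-1^[n%2] α ⟩
        (-1ℤ) ^ (α % 2)         ≡⟨ cong ((-1ℤ) ^_) (n%4%2≡n%2 α) ⟨
        (-1ℤ) ^ (α % 4 % 2)     ≡⟨ cong (λ k → (-1ℤ) ^ (k % 2)) α%4≡r ⟩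
        (-1ℤ) ^ (r % 2)         ∎
        where open ≈-Reasoning

      2∣α : ∀ {r} → 2 ∣ r → α % 4 ≡ r → 2 ∣ α
      2∣α 2∣r α%4≡r = ℕ.∣n∣m%n⇒∣m (ℕ.divides 2 refl) (subst (2 ∣_) (sym α%4≡r) 2∣r)

      classify : 1 < m → ∀ {t} → IsOrder c t → ωClass α t
      classify 1<m order with α % 4 in α%4≡r | ℕ.m%n<n α 4
      ... | 0 | _ = ω≡2 (2∣α (2 ℕ.∣0) α%4≡r) (order≡2 c≉1 (c²≈-1^[r%2] α%4≡r) order)
        where
        c≉1 : ¬ c ≈ 1ℤ
        c≉1 = 4∣α⇒c≉1 (ℕ.m%n≡0⇒n∣m α 4 α%4≡r)
      ... | 1 | _ =
        ω≡4 (inj₁ α%4≡r) (order≡4 (1≉-1 m%2≡1 1<m) (c²≈-1^[r%2] α%4≡r) order)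
      ... | 2 | _ with c ≈? 1ℤ
      ...   | yes c≈1 = ω≡1 (2∣α ℕ.∣-refl α%4≡r) ¬4∣α (order≡1 c≈1 order)
        where
        ¬4∣α : ¬ 4 ∣ α
        ¬4∣α 4∣α with () ← trans (sym (ℕ.n∣m⇒m%n≡0 α 4 4∣α)) α%4≡r
      ...   | no c≉1  = ω≡2 (2∣α ℕ.∣-refl α%4≡r) (order≡2 c≉1 (c²≈-1^[r%2] α%4≡r) order)
      classify 1<m order | 3 | _ =
        ω≡4 (inj₂ α%4≡r) (order≡4 (1≉-1 m%2≡1 1<m) (c²≈-1^[r%2] α%4≡r) order)
      classify 1<m order | suc (suc (suc (suc _))) | s≤s (s≤s (s≤s (s≤s ())))

theorem4p22 : (K : ℤ) (m : ℕ) → m % 2 ≡ 1 → 1 < m →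
    (p a : ℕ) → IsPi K m p → IsAlpha K m a →
    ((3 < m → (ω K m p ≡ 4 ⇔ (a % 4 ≡ 1 ⊎ a % 4 ≡ 3)))
    × (ω K m p ≡ 2 ⇔ (4 ∣ p × 2 ∣ a))
    × (ω K m p ≡ 1 ⇔ (¬ (4 ∣ p))))
theorem4p22 K m m%2≡1 1<m p zero      _   ((() , _) , _)
theorem4p22 K m m%2≡1 1<m p (suc α-1) isπ ((_ , m∣F[α]) , α-least) =
  let t , p≡t*α , order = π≡ord*α isπ
      ω≡t = trans (cong (countZeros K m) p≡t*α) (countZeros-multiples α-1 m∣F[n]⇔α∣n t)
  in  ωClass⇒criteria ω≡t p≡t*α (classify m%2≡1 1<m order)
  where
  open Vanishing K m α-1 m∣F[α]
  open EntryPoint α-least
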